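{- Let $T,T'\in\mathcal{T}_n$ and $i\in\{1,\dots,n\}$. (i) If $\mathrm{ld}_T(j)=\mathrm{ld}_{T'}(j)$ for all $j\in\{1,\dots,i\}$, then $\mathrm{addr}_T(j)=\mathrm{addr}_{T'}(j)$ for all $j\in\{1,\dots,i\}$. (ii) If $\mathrm{rd}_T(j)=\mathrm{rd}_{T'}(j)$ for all $j\in\{i,\dots,n\}$, then $\mathrm{addr}_T(j)=\mathrm{addr}_{T'}(j)$ for all $j\in\{i,\dots,n\}$.
   Context: $\mathcal{T}_n$ is the set of binary trees (rooted plane trees in which each internal vertex has an ordered left and right child) with $n$ leaves, numbered $1,\dots,n$ from left to right. The address $\mathrm{addr}_T(v)$ is the word over $\{0,1\}$ recording the path from the root to $v$ ($0$ = left step, $1$ = right step); $\mathrm{ld}_T(v)$ and $\mathrm{rd}_T(v)$ are the numbers of $0$'s and $1$'s in $\mathrm{addr}_T(v)$. -}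

module Defs where

open import Data.Nat using (ℕ; zero; suc; _+_)
open import Data.Fin using (Fin; zero; suc; splitAt)
open import Data.Sum using (inj₁; inj₂)
open import Data.List using (List; []; _∷_; length; filter)

data Bit : Set where
  b0 b1 : Bit

data BT : ℕ → Set where
  leaf : BT 1
  node : ∀ {m k} → BT m → BT k → BT (m + k)

-- addr T j : the word over {0,1} recording the path from the root to the
-- leaf j (leaves numbered 0..n-1 from left to right, i.e. Fin n; paper's
-- leaf j+1).
addr : ∀ {n} → BT n → Fin n → List Bit
addr leaf zero = []
addr (node {m} {k} l r) j with splitAt m j
... | inj₁ a = b0 ∷ addr l a
... | inj₂ b = b1 ∷ addr r b

count : Bit → List Bit → ℕ
count c [] = zero
count b0 (b0 ∷ w) = suc (count b0 w)
count b0 (b1 ∷ w) = count b0 w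
count b1 (b0 ∷ w) = count b1 w
count b1 (b1 ∷ w) = suc (count b1 w)

ld : ∀ {n} → BT n → Fin n → ℕ
ld T j = count b0 (addr T j)

rd : ∀ {n} → BT n → Fin n → ℕ
rd T j = count b1 (addr T j)

-- The left depths of a prefix of leaves locate the root split. A leaf of the
-- left subtree has left depth one more than in that subtree, and within any
-- tree only the last leaf has left depth 0; so the last leaf of the left subtree
-- is the first leaf of left depth 1. Hence two trees whose left depths agree on
-- leaves 0 … i either both contain leaf i in their left subtrees, or have left
-- subtrees with the same number of leaves, and (i) follows by induction on the
-- trees. Mirroring a tree and swapping the letters of addresses reverses the
-- order of the leaves and exchanges left and right depths, so (ii) is (i) for
-- the mirror images.

module Submission where

open import Defs
open import Data.Nat using (ℕ; suc; _+_; _∸_; pred; z≤n; s≤s; s≤s⁻¹; _≤_; _<_; _<?_; >-nonZero)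
open import Data.Nat.Properties
open import Data.Fin as Fin using (Fin; toℕ; splitAt; fromℕ<)
open import Data.Fin.Properties using (toℕ-↑ˡ; toℕ-↑ʳ; toℕ<n; splitAt⁻¹-↑ˡ; splitAt⁻¹-↑ʳ; toℕ-fromℕ<)
open import Data.Product using (_×_; _,_)
open import Data.Sum using (inj₁; inj₂)
open import Data.List using (List; []; _∷_; map)
open import Data.List.Properties using (map-injective)
open import Function using (_∘_)
open import Data.Empty using (⊥-elim)
open import Relation.Nullary using (yes; no)
open import Relation.Binary.PropositionalEquality
  using (_≡_; refl; sym; trans; cong; cong₂; subst; module ≡-Reasoning)

m+[1+n∸m]≡1+n : ∀ {m n} → m ≤ n → m + suc (n ∸ m) ≡ suc n
m+[1+n∸m]≡1+n {m} {n} m≤n = trans (+-suc m (n ∸ m)) (cong suc (m+[n∸m]≡n m≤n))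

m∸1+n<m : ∀ {m} n → 0 < m → m ∸ suc n < m
m∸1+n<m {suc m} n _ = s≤s (m∸n≤m m n)

m∸[1+m∸1+n]≡n : ∀ {m n} → n < m → m ∸ suc (m ∸ suc n) ≡ n
m∸[1+m∸1+n]≡n {suc m} (s≤s n≤m) = m∸[m∸n]≡n n≤m

k≤m∸1+n⇒n≤m∸1+k : ∀ {m n k} → n < m → k ≤ m ∸ suc n → n ≤ m ∸ suc k
k≤m∸1+n⇒n≤m∸1+k {suc m} {n} {k} (s≤s n≤m) k≤m∸1+n =
  m+n≤o⇒m≤o∸n n (subst (_≤ m) (+-comm k n) (m≤o∸n⇒m+n≤o k n≤m k≤m∸1+n))

-- Trees without the leaf-count index: two nodes of BT n cannot be matched
-- simultaneously, since their index equation m + k ≡ m′ + k′ does not unify.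
data Shape : Set where
  leaf : Shape
  node : Shape → Shape → Shape

leaves : Shape → ℕ
leaves leaf       = 1
leaves (node l r) = leaves l + leaves r

-- Leaves are numbered 0, 1, … from the left; positions beyond the last leaf
-- are sent to the rightmost path.
address : Shape → ℕ → List Bit
address leaf       j = []
address (node l r) j with j <? leaves l
... | yes _ = b0 ∷ address l j
... | no  _ = b1 ∷ address r (j ∸ leaves l)

leftDepth rightDepth : Shape → ℕ → ℕ
leftDepth  t j = count b0 (address t j)
rightDepth t j = count b1 (address t j)

leaves-positive : ∀ t → 0 < leaves t
leaves-positive leaf       = s≤s z≤n
leaves-positive (node l r) = <-≤-trans (leaves-positive l) (m≤m+n (leaves l) (leaves r))

suc-pred-leaves : ∀ t → suc (pred (leaves t)) ≡ leaves t
suc-pred-leaves t = suc-pred (leaves t) {{>-nonZero (leaves-positive t)}}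

address-left : ∀ l r {j} → j < leaves l → address (node l r) j ≡ b0 ∷ address l j
address-left l r {j} j<m with j <? leaves l
... | yes _   = refl
... | no  j≮m = ⊥-elim (j≮m j<m)

address-right : ∀ l r {j} → leaves l ≤ j → address (node l r) j ≡ b1 ∷ address r (j ∸ leaves l)
address-right l r {j} m≤j with j <? leaves l
... | yes j<m = ⊥-elim (<⇒≱ j<m m≤j)
... | no  _   = refl

address-right+ : ∀ l r j → address (node l r) (leaves l + j) ≡ b1 ∷ address r j
address-right+ l r j = trans (address-right l r (m≤m+n (leaves l) j))
                             (cong (λ k → b1 ∷ address r k) (m+n∸m≡n (leaves l) j))

leftDepth-left : ∀ l r {j} → j < leaves l → leftDepth (node l r) j ≡ suc (leftDepth l j)
leftDepth-left l r j<m = cong (count b0) (address-left l r j<m)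

leftDepth-right : ∀ l r j → leftDepth (node l r) (leaves l + j) ≡ leftDepth r j
leftDepth-right l r j = cong (count b0) (address-right+ l r j)

leftDepth-last : ∀ t {j} → leaves t ≤ suc j → leftDepth t j ≡ 0
leftDepth-last leaf       _ = refl
leftDepth-last (node l r) {j} n≤1+j with j <? leaves l
... | yes j<m = ⊥-elim (<⇒≱ j<m (s≤s⁻¹ (<-≤-trans (m<m+n (leaves l) (leaves-positive r)) n≤1+j)))
... | no  j≮m = leftDepth-last r (+-cancelˡ-≤ (leaves l) _ _
                  (subst (leaves l + leaves r ≤_) (sym (m+[1+n∸m]≡1+n (≮⇒≥ j≮m))) n≤1+j))

leftDepth≡0⇒last : ∀ t {j} → leftDepth t j ≡ 0 → leaves t ≤ suc j
leftDepth≡0⇒last leaf       _ = s≤s z≤n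
leftDepth≡0⇒last (node l r) {j} d≡0 with j <? leaves l
leftDepth≡0⇒last (node l r) () | yes _
... | no  j≮m = subst (leaves l + leaves r ≤_) (m+[1+n∸m]≡1+n (≮⇒≥ j≮m))
                  (+-monoʳ-≤ (leaves l) (leftDepth≡0⇒last r d≡0))

AgreeUpTo : ℕ → (ℕ → ℕ) → (ℕ → ℕ) → Set
AgreeUpTo i f g = ∀ j → j ≤ i → f j ≡ g j

AgreeUpTo-sym : ∀ {i f g} → AgreeUpTo i f g → AgreeUpTo i g f
AgreeUpTo-sym f≡g j j≤i = sym (f≡g j j≤i)

AgreeUpTo-left : ∀ l r l′ r′ {i} → i < leaves l → i < leaves l′ →
  AgreeUpTo i (leftDepth (node l r)) (leftDepth (node l′ r′)) →
  AgreeUpTo i (leftDepth l) (leftDepth l′)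
AgreeUpTo-left l r l′ r′ i<m i<m′ agree j j≤i = suc-injective (begin
  suc (leftDepth l j)       ≡⟨ leftDepth-left l r (≤-<-trans j≤i i<m) ⟨
  leftDepth (node l r) j    ≡⟨ agree j j≤i ⟩
  leftDepth (node l′ r′) j  ≡⟨ leftDepth-left l′ r′ (≤-<-trans j≤i i<m′) ⟩
  suc (leftDepth l′ j)      ∎)
  where open ≡-Reasoning

AgreeUpTo-right : ∀ l r l′ r′ {i} → leaves l ≡ leaves l′ →
  AgreeUpTo (leaves l + i) (leftDepth (node l r)) (leftDepth (node l′ r′)) →
  AgreeUpTo i (leftDepth r) (leftDepth r′)
AgreeUpTo-right l r l′ r′ m≡m′ agree j j≤i = begin
  leftDepth r j                          ≡⟨ leftDepth-right l r j ⟨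
  leftDepth (node l r) (leaves l + j)    ≡⟨ agree (leaves l + j) (+-monoʳ-≤ (leaves l) j≤i) ⟩
  leftDepth (node l′ r′) (leaves l + j)  ≡⟨ cong (λ m → leftDepth (node l′ r′) (m + j)) m≡m′ ⟩
  leftDepth (node l′ r′) (leaves l′ + j) ≡⟨ leftDepth-right l′ r′ j ⟩
  leftDepth r′ j                         ∎
  where open ≡-Reasoning

leaves-left-≤ : ∀ l r l′ r′ {i} → leaves l ≤ i →
  AgreeUpTo i (leftDepth (node l r)) (leftDepth (node l′ r′)) →
  leaves l′ ≤ leaves l
leaves-left-≤ l r l′ r′ {i} m≤i agree = bound (suc-pred-leaves l) (≤-trans pred[n]≤n m≤i)
  where
  open ≡-Reasoning
  bound : ∀ {j} → suc j ≡ leaves l → j ≤ i → leaves l′ ≤ leaves l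
  bound {j} 1+j≡m j≤i with j <? leaves l′
  ... | no  j≮m′ = ≤-trans (≮⇒≥ j≮m′) (≤-trans (n≤1+n j) (≤-reflexive 1+j≡m))
  ... | yes j<m′ = subst (leaves l′ ≤_) 1+j≡m (leftDepth≡0⇒last l′ (suc-injective (begin
    suc (leftDepth l′ j)     ≡⟨ leftDepth-left l′ r′ j<m′ ⟨
    leftDepth (node l′ r′) j ≡⟨ agree j j≤i ⟨
    leftDepth (node l r) j   ≡⟨ leftDepth-left l r (≤-reflexive 1+j≡m) ⟩
    suc (leftDepth l j)      ≡⟨ cong suc (leftDepth-last l (≤-reflexive (sym 1+j≡m))) ⟩
    1                        ∎)))

leftDepths-determine-address : ∀ t t′ {i} → AgreeUpTo i (leftDepth t) (leftDepth t′) →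
  address t i ≡ address t′ i
leftDepths-determine-address leaf leaf _ = refl
leftDepths-determine-address leaf (node l′ r′) agree =
  ⊥-elim (0≢1+n (trans (agree 0 z≤n) (leftDepth-left l′ r′ (leaves-positive l′))))
leftDepths-determine-address (node l r) leaf agree =
  ⊥-elim (0≢1+n (trans (sym (agree 0 z≤n)) (leftDepth-left l r (leaves-positive l))))
leftDepths-determine-address (node l r) (node l′ r′) {i} agree with i <? leaves l | i <? leaves l′
... | yes i<m | yes i<m′ =
  cong (b0 ∷_) (leftDepths-determine-address l l′ (AgreeUpTo-left l r l′ r′ i<m i<m′ agree))
... | yes i<m | no  i≮m′ = ⊥-elim (<⇒≱ i<m (≤-trans m≤m′ m′≤i))
  where
  m′≤i = ≮⇒≥ i≮m′
  m≤m′ = leaves-left-≤ l′ r′ l r m′≤i (AgreeUpTo-sym agree)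
... | no  i≮m | yes i<m′ = ⊥-elim (<⇒≱ i<m′ (≤-trans m′≤m m≤i))
  where
  m≤i = ≮⇒≥ i≮m
  m′≤m = leaves-left-≤ l r l′ r′ m≤i agree
... | no  i≮m | no  i≮m′ = cong (b1 ∷_) (begin
  address r (i ∸ leaves l)   ≡⟨ leftDepths-determine-address r r′ (AgreeUpTo-right l r l′ r′ m≡m′ agree′) ⟩
  address r′ (i ∸ leaves l)  ≡⟨ cong (λ m → address r′ (i ∸ m)) m≡m′ ⟩
  address r′ (i ∸ leaves l′) ∎)
  where
  open ≡-Reasoning
  m≤i = ≮⇒≥ i≮m
  m≡m′ : leaves l ≡ leaves l′
  m≡m′ = ≤-antisym (leaves-left-≤ l′ r′ l r (≮⇒≥ i≮m′) (AgreeUpTo-sym agree))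
                   (leaves-left-≤ l r l′ r′ m≤i agree)
  agree′ : AgreeUpTo (leaves l + (i ∸ leaves l)) (leftDepth (node l r)) (leftDepth (node l′ r′))
  agree′ = subst (λ k → AgreeUpTo k (leftDepth (node l r)) (leftDepth (node l′ r′)))
                 (sym (m+[n∸m]≡n m≤i)) agree

flipBit : Bit → Bit
flipBit b0 = b1
flipBit b1 = b0

flipBit-involutive : ∀ b → flipBit (flipBit b) ≡ b
flipBit-involutive b0 = refl
flipBit-involutive b1 = refl

flipBit-injective : ∀ {b c} → flipBit b ≡ flipBit c → b ≡ c
flipBit-injective {b} {c} eq =
  trans (sym (flipBit-involutive b)) (trans (cong flipBit eq) (flipBit-involutive c))

count-b0-map-flipBit : ∀ w → count b0 (map flipBit w) ≡ count b1 w
count-b0-map-flipBit []       = refl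
count-b0-map-flipBit (b0 ∷ w) = count-b0-map-flipBit w
count-b0-map-flipBit (b1 ∷ w) = cong suc (count-b0-map-flipBit w)

mirror : Shape → Shape
mirror leaf       = leaf
mirror (node l r) = node (mirror r) (mirror l)

leaves-mirror : ∀ t → leaves (mirror t) ≡ leaves t
leaves-mirror leaf       = refl
leaves-mirror (node l r) = trans (cong₂ _+_ (leaves-mirror r) (leaves-mirror l)) (+-comm (leaves r) (leaves l))

-- No bound on j is needed: beyond the last leaf both sides are the rightmost path.
address-mirror : ∀ t j → address (mirror t) j ≡ map flipBit (address t (leaves t ∸ suc j))
address-mirror leaf       j = refl
address-mirror (node l r) j with j <? leaves r
... | yes j<b = begin
  address (node (mirror r) (mirror l)) j          ≡⟨ address-left (mirror r) (mirror l) j<b′ ⟩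
  b0 ∷ address (mirror r) j                       ≡⟨ cong (b0 ∷_) (address-mirror r j) ⟩
  map flipBit (b1 ∷ address r (b ∸ suc j))        ≡⟨ cong (map flipBit) (address-right+ l r (b ∸ suc j)) ⟨
  map flipBit (address (node l r) (a + (b ∸ suc j))) ≡⟨ cong (map flipBit ∘ address (node l r)) (+-∸-assoc a j<b) ⟨
  map flipBit (address (node l r) (a + b ∸ suc j))   ∎
  where
  open ≡-Reasoning
  a = leaves l
  b = leaves r
  j<b′ = subst (j <_) (sym (leaves-mirror r)) j<b
... | no  j≮b = begin
  address (node (mirror r) (mirror l)) j          ≡⟨ address-right (mirror r) (mirror l) b′≤j ⟩
  b1 ∷ address (mirror l) (j ∸ leaves (mirror r)) ≡⟨ cong (λ k → b1 ∷ address (mirror l) (j ∸ k)) (leaves-mirror r) ⟩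
  b1 ∷ address (mirror l) x                       ≡⟨ cong (b1 ∷_) (address-mirror l x) ⟩
  map flipBit (b0 ∷ address l (a ∸ suc x))        ≡⟨ cong (map flipBit) (address-left l r (m∸1+n<m x (leaves-positive l))) ⟨
  map flipBit (address (node l r) (a ∸ suc x))    ≡⟨ cong (map flipBit ∘ address (node l r)) reflect ⟨
  map flipBit (address (node l r) (a + b ∸ suc j)) ∎
  where
  open ≡-Reasoning
  a = leaves l
  b = leaves r
  x = j ∸ b
  b≤j = ≮⇒≥ j≮b
  b′≤j = subst (_≤ j) (sym (leaves-mirror r)) b≤j
  reflect : a + b ∸ suc j ≡ a ∸ suc x
  reflect = begin
    a + b ∸ suc j        ≡⟨ cong (_∸ suc j) (+-comm a b) ⟩
    b + a ∸ suc j        ≡⟨ cong (b + a ∸_) (m+[1+n∸m]≡1+n b≤j) ⟨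
    b + a ∸ (b + suc x)  ≡⟨ [m+n]∸[m+o]≡n∸o b a (suc x) ⟩
    a ∸ suc x            ∎

address-mirror-reflect : ∀ t {j} → j < leaves t →
  address (mirror t) (leaves t ∸ suc j) ≡ map flipBit (address t j)
address-mirror-reflect t j<n =
  trans (address-mirror t _) (cong (map flipBit ∘ address t) (m∸[1+m∸1+n]≡n j<n))

leftDepth-mirror : ∀ t k → leftDepth (mirror t) k ≡ rightDepth t (leaves t ∸ suc k)
leftDepth-mirror t k = trans (cong (count b0) (address-mirror t k)) (count-b0-map-flipBit (address t (leaves t ∸ suc k)))

rightDepths-determine-address : ∀ t t′ {j} → leaves t ≡ leaves t′ → j < leaves t →
  (∀ k → j ≤ k → k < leaves t → rightDepth t k ≡ rightDepth t′ k) →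
  address t j ≡ address t′ j
rightDepths-determine-address t t′ {j} n≡n′ j<n agree = map-injective flipBit-injective (begin
  map flipBit (address t j)                 ≡⟨ address-mirror-reflect t j<n ⟨
  address (mirror t) (leaves t ∸ suc j)     ≡⟨ leftDepths-determine-address (mirror t) (mirror t′) mirror-agree ⟩
  address (mirror t′) (leaves t ∸ suc j)    ≡⟨ cong (λ n → address (mirror t′) (n ∸ suc j)) n≡n′ ⟩
  address (mirror t′) (leaves t′ ∸ suc j)   ≡⟨ address-mirror-reflect t′ (subst (j <_) n≡n′ j<n) ⟩
  map flipBit (address t′ j)                ∎)
  where
  open ≡-Reasoning
  mirror-agree : AgreeUpTo (leaves t ∸ suc j) (leftDepth (mirror t)) (leftDepth (mirror t′))
  mirror-agree k k≤i = begin
    leftDepth (mirror t) k             ≡⟨ leftDepth-mirror t k ⟩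
    rightDepth t (leaves t ∸ suc k)    ≡⟨ agree _ (k≤m∸1+n⇒n≤m∸1+k j<n k≤i) (m∸1+n<m k (leaves-positive t)) ⟩
    rightDepth t′ (leaves t ∸ suc k)   ≡⟨ cong (λ n → rightDepth t′ (n ∸ suc k)) n≡n′ ⟩
    rightDepth t′ (leaves t′ ∸ suc k)  ≡⟨ leftDepth-mirror t′ k ⟨
    leftDepth (mirror t′) k            ∎

shape : ∀ {n} → BT n → Shape
shape leaf       = leaf
shape (node l r) = node (shape l) (shape r)

leaves-shape : ∀ {n} (T : BT n) → leaves (shape T) ≡ n
leaves-shape leaf       = refl
leaves-shape (node l r) = cong₂ _+_ (leaves-shape l) (leaves-shape r)

address-shape : ∀ {n} (T : BT n) (j : Fin n) → address (shape T) (toℕ j) ≡ addr T j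
address-shape leaf                 Fin.zero = refl
address-shape (node {m} {k} l r) j with splitAt m j in split≡
... | inj₁ a = begin
  address (shape (node l r)) (toℕ j) ≡⟨ cong (address (shape (node l r))) j≡a ⟩
  address (shape (node l r)) (toℕ a) ≡⟨ address-left (shape l) (shape r) a<m ⟩
  b0 ∷ address (shape l) (toℕ a)     ≡⟨ cong (b0 ∷_) (address-shape l a) ⟩
  b0 ∷ addr l a                      ∎
  where
  open ≡-Reasoning
  j≡a : toℕ j ≡ toℕ a
  j≡a = trans (cong toℕ (sym (splitAt⁻¹-↑ˡ split≡))) (toℕ-↑ˡ a k)
  a<m = subst (toℕ a <_) (sym (leaves-shape l)) (toℕ<n a)
... | inj₂ b = begin
  address (shape (node l r)) (toℕ j)                    ≡⟨ cong (address (shape (node l r))) j≡m+b ⟩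
  address (shape (node l r)) (leaves (shape l) + toℕ b) ≡⟨ address-right+ (shape l) (shape r) (toℕ b) ⟩
  b1 ∷ address (shape r) (toℕ b)                        ≡⟨ cong (b1 ∷_) (address-shape r b) ⟩
  b1 ∷ addr r b                                         ∎
  where
  open ≡-Reasoning
  j≡m+b : toℕ j ≡ leaves (shape l) + toℕ b
  j≡m+b = trans (cong toℕ (sym (splitAt⁻¹-↑ʳ split≡)))
                (trans (toℕ-↑ʳ m b) (cong (_+ toℕ b) (sym (leaves-shape l))))

count-address-shape : ∀ {n} (T : BT n) c {k} (k<n : k < n) →
  count c (address (shape T) k) ≡ count c (addr T (fromℕ< k<n))
count-address-shape T c k<n =
  cong (count c) (trans (cong (address (shape T)) (sym (toℕ-fromℕ< k<n))) (address-shape T _))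

ld-prefix-determines-addr : ∀ {n} (T T′ : BT n) (j : Fin n) →
  ((k : Fin n) → k Fin.≤ j → ld T k ≡ ld T′ k) → addr T j ≡ addr T′ j
ld-prefix-determines-addr T T′ j agree = begin
  addr T j                   ≡⟨ address-shape T j ⟨
  address (shape T) (toℕ j)  ≡⟨ leftDepths-determine-address (shape T) (shape T′) shape-agree ⟩
  address (shape T′) (toℕ j) ≡⟨ address-shape T′ j ⟩
  addr T′ j                  ∎
  where
  open ≡-Reasoning
  shape-agree : AgreeUpTo (toℕ j) (leftDepth (shape T)) (leftDepth (shape T′))
  shape-agree k k≤j = trans (count-address-shape T b0 k<n)
    (trans (agree _ (subst (_≤ toℕ j) (sym (toℕ-fromℕ< k<n)) k≤j)) (sym (count-address-shape T′ b0 k<n)))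
    where k<n = ≤-<-trans k≤j (toℕ<n j)

rd-suffix-determines-addr : ∀ {n} (T T′ : BT n) (j : Fin n) →
  ((k : Fin n) → j Fin.≤ k → rd T k ≡ rd T′ k) → addr T j ≡ addr T′ j
rd-suffix-determines-addr T T′ j agree = begin
  addr T j                   ≡⟨ address-shape T j ⟨
  address (shape T) (toℕ j)  ≡⟨ rightDepths-determine-address (shape T) (shape T′) n≡n′ j<m shape-agree ⟩
  address (shape T′) (toℕ j) ≡⟨ address-shape T′ j ⟩
  addr T′ j                  ∎
  where
  open ≡-Reasoning
  n≡n′ = trans (leaves-shape T) (sym (leaves-shape T′))
  j<m = subst (toℕ j <_) (sym (leaves-shape T)) (toℕ<n j)
  shape-agree : ∀ k → toℕ j ≤ k → k < leaves (shape T) → rightDepth (shape T) k ≡ rightDepth (shape T′) k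
  shape-agree k j≤k k<m = trans (count-address-shape T b1 k<n)
    (trans (agree _ (subst (toℕ j ≤_) (sym (toℕ-fromℕ< k<n)) j≤k)) (sym (count-address-shape T′ b1 k<n)))
    where k<n = subst (k <_) (leaves-shape T) k<m

lemma2p3 : ∀ {n} (T T′ : BT n) (i : Fin n) →
    (((j : Fin n) → j Fin.≤ i → ld T j ≡ ld T′ j) →
      (j : Fin n) → j Fin.≤ i → addr T j ≡ addr T′ j)
    × (((j : Fin n) → i Fin.≤ j → rd T j ≡ rd T′ j) →
      (j : Fin n) → i Fin.≤ j → addr T j ≡ addr T′ j)
lemma2p3 T T′ i =
  (λ agree j j≤i → ld-prefix-determines-addr T T′ j (λ k k≤j → agree k (≤-trans k≤j j≤i))) ,
  (λ agree j i≤j → rd-suffix-determines-addr T T′ j (λ k j≤k → agree k (≤-trans i≤j j≤k)))
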